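{- Let $M$ be a matroid on a finite ground set $E$ with set of bases $\mathcal{B}(M)$, and let $<$ be a total order of $\mathcal{B}(M)$. Let $<_\bullet$ be the corresponding order of the facets of the dual matroid polytope $P_M^*$ (the facet $F_B$ of $P_M^*$ corresponding to the basis $B$ precedes $F_{B'}$ iff $B<B'$). If $<_\bullet$ is a shelling order of the polytope $P_M^*$, then $<$ is a shelling order of the independence complex $\mathcal{I}(M)$.
   Context: A matroid $M$ on $E$ is given by its independence complex $\mathcal{I}(M)\subseteq 2^E$; its facets are the bases, all of the same size. The matroid polytope is $P_M=\mathrm{conv}\{\chi_B : B\in\mathcal{B}(M)\}\subset\mathbb{R}^E$, where $\chi_B$ is the characteristic vector of $B$. The dual polytope $P_M^*$ is any polytope whose face lattice is the opposite of the face lattice of $P_M$; in particular its facets correspond bijectively to the vertices $\chi_B$ of $P_M$, the facet corresponding to $\chi_B$ being denoted $F_B$. A shelling order of a pure simplicial complex is a total order $F_1<\dots<F_k$ of its facets such that for each $j\ge 2$, the complex $\langle F_1,\dots,F_{j-1}\rangle\cap\langle F_j\rangle$ is pure of dimension $\dim F_j-1$ (here $\langle\mathcal{G}\rangle$ is the complex generated by the sets in $\mathcal{G}$). A shelling of a polygon is an order of its edges in which each edge other than the first shares a vertex with some earlier edge; a shelling of a polytope $P$ of dimension at least $3$ is an order $F_1,\dots,F_k$ of its facets such that for each $j\ge 2$, $F_j\cap\bigcup_{i<j}F_i$ is a union of facets of $F_j$ forming an initial segment of some shelling of $F_j$. -}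

module Defs where

open import Data.Nat as ℕ using (ℕ; zero; suc; _∸_)
open import Data.Integer as ℤ using (ℤ)
open import Data.Bool using (Bool; true; false; if_then_else_)
open import Data.Fin as Fin using (Fin; toℕ)
open import Data.Fin.Subset using (Subset; ⊥; ⊤; ⁅_⁆; _∈_; _∉_; _⊆_; _⊂_; _∪_; ∣_∣)
open import Data.Vec using ([]; _∷_)
open import Data.List as List using (List; length; lookup; take)
import Data.List.Membership.Propositional as L
open import Data.List.Relation.Unary.Unique.Propositional using (Unique)
open import Data.Product using (Σ; ∃; _×_; _,_)
open import Data.Empty renaming (⊥ to Empty)
open import Data.Sum using (_⊎_)
open import Relation.Binary.PropositionalEquality using (_≡_)
open import Function using (_∘_)

record Matroid (n : ℕ) : Set₁ where
  field
    Indep   : Subset n → Set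
    indep-∅ : Indep ⊥
    indep-⊆ : ∀ {I J} → J ⊆ I → Indep I → Indep J
    augment : ∀ {I J} → Indep I → Indep J → ∣ I ∣ ℕ.< ∣ J ∣ →
              ∃ λ x → x ∈ J × x ∉ I × Indep (I ∪ ⁅ x ⁆)

  -- bases = facets (maximal faces) of the independence complex
  IsBasis : Subset n → Set
  IsBasis B = Indep B × (∀ J → Indep J → B ⊆ J → J ≡ B)

-- A total order of the set of bases B(M): an enumeration β : Fin k → bases,
-- bijective onto B(M); β i < β j iff i < j.
record BasisOrder {n : ℕ} (M : Matroid n) (k : ℕ) (β : Fin k → Subset n) : Set where
  field
    β-basis  : ∀ i → Matroid.IsBasis M (β i)
    β-inj    : ∀ i j → β i ≡ β j → i ≡ j
    β-onto   : ∀ B → Matroid.IsBasis M B → ∃ λ i → β i ≡ B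

-- C is pure of the dimension whose faces of maximal size have cardinality c
-- (i.e. dimension c - 1): every face lies in a face of cardinality c, and
-- no face has larger cardinality.
PureOfCard : ∀ {n} → (Subset n → Set) → ℕ → Set
PureOfCard C c =
  (∀ σ → C σ → ∃ λ τ → C τ × σ ⊆ τ × ∣ τ ∣ ≡ c) × (∀ σ → C σ → ∣ σ ∣ ℕ.≤ c)

-- <F_1,…,F_{j-1}> ∩ <F_j> is pure of dimension dim F_j - 1 for all j ≥ 2
IsComplexShelling : ∀ {n k} → (Fin k → Subset n) → Set
IsComplexShelling {n} {k} β =
  ∀ (j : Fin k) → 1 ℕ.≤ toℕ j →
    PureOfCard (λ σ → σ ⊆ β j × ∃ λ i → i Fin.< j × σ ⊆ β i) (∣ β j ∣ ∸ 1)

-- The matroid polytope P_M = conv{χ_B} and its face lattice.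
-- Vertices of P_M are indexed by Fin k (vertex i = χ_{β i}); a face is
-- recorded by its set of vertices, a Subset k.

weight : ∀ {n} → (Fin n → ℤ) → Subset n → ℤ
weight w []          = ℤ.+ 0
weight w (b ∷ B) = (if b then w Fin.zero else ℤ.+ 0) ℤ.+ weight (w ∘ Fin.suc) B

-- nonempty faces: sets of vertices maximising a linear functional
-- (integral functionals suffice for the rational polytope P_M)
Exposed : ∀ {n k} → (Fin k → Subset n) → Subset k → Set
Exposed {n} {k} β S = ∃ λ (w : Fin n → ℤ) → ∀ i →
  (i ∈ S → ∀ j → weight w (β j) ℤ.≤ weight w (β i)) ×
  ((∀ j → weight w (β j) ℤ.≤ weight w (β i)) → i ∈ S)

IsFace : ∀ {n k} → (Fin k → Subset n) → Subset k → Set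
IsFace β S = S ≡ ⊥ ⊎ Exposed β S

Covers : ∀ {n k} → (Fin k → Subset n) → Subset k → Subset k → Set
Covers β G G' = IsFace β G × IsFace β G' × G ⊂ G' ×
  (∀ K → IsFace β K → G ⊂ K → K ⊂ G' → Empty)

Chain : ∀ {n k} → (Fin k → Subset n) → Subset k → ℕ → Set
Chain β G zero    = G ≡ ⊤
Chain β G (suc m) = ∃ λ G' → Covers β G G' × Chain β G' m

-- The dual polytope P_M^*, described through the face lattice of P_M
-- reversed: a face G of P_M corresponds to the face D(G) of P_M^*;
-- D(G) ⊆ D(G') iff G' ⊆ G; the facets of D(G) are the D(G') with G ⋖ G';
-- dim D(G) = d iff Chain β G (suc d); P_M^* = D(⊥) and its facet
-- F_{β i} is D(⁅ i ⁆).

FacetOrder : ∀ {n k} → (Fin k → Subset n) → Subset k → List (Subset k) → Set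
FacetOrder β G L = (∀ X → (X L.∈ L → Covers β G X) × (Covers β G X → X L.∈ L)) × Unique L

-- Shelling d β G L : L is a shelling of the d-dimensional polytope D(G).
Shelling : ∀ {n k} → ℕ → (Fin k → Subset n) → Subset k → List (Subset k) → Set
-- dimension ≤ 1: every ordering of the facets is a shelling
Shelling zero β G L = FacetOrder β G L
Shelling (suc zero) β G L = FacetOrder β G L
-- polygon: each edge after the first shares a vertex D(K) (dim D(K) = 0)
-- with some earlier edge
Shelling (suc (suc zero)) β G L = FacetOrder β G L ×
  (∀ (j : Fin (length L)) → 1 ℕ.≤ toℕ j →
     ∃ λ i → i Fin.< j × ∃ λ K → Chain β K 1 ×
       lookup L j ⊆ K × lookup L i ⊆ K)
-- dimension ≥ 3: for j ≥ 2, D(G_j) ∩ ⋃_{i<j} D(G_i) is the union of the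
-- facets of D(G_j) in a nonempty initial segment (first r facets) of some
-- shelling L' of D(G_j).  As point sets: every facet in the segment lies in
-- some earlier D(G_i), and every face D(K) lying in D(G_j) and in some
-- earlier D(G_i) lies in some facet of the segment.
Shelling (suc (suc (suc d))) β G L = FacetOrder β G L ×
  (∀ (j : Fin (length L)) → 1 ℕ.≤ toℕ j →
     ∃ λ L' → Shelling (suc (suc d)) β (lookup L j) L' ×
     ∃ λ r → 1 ℕ.≤ r × r ℕ.≤ length L' ×
       (∀ X → X L.∈ take r L' → ∃ λ i → i Fin.< j × lookup L i ⊆ X) ×
       (∀ K → IsFace β K → lookup L j ⊆ K →
          (∃ λ i → i Fin.< j × lookup L i ⊆ K) →
          ∃ λ X → X L.∈ take r L' × X ⊆ K))

dualFacetOrder : (k : ℕ) → List (Subset k)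
dualFacetOrder k = List.map ⁅_⁆ (List.allFin k)

module Submission where

-- Bases β i, β j are adjacent (Adj) when β i ∖ β j is a single element; these
-- pairs are exactly the edges of P_M.  By the usual criterion for pure
-- complexes (shelling-criterion) it suffices that every β j, j ≥ 1, is
-- attached: each σ ⊆ β j lying in an earlier basis lies in an earlier basis
-- adjacent to β j.  The faces of P_M we work with are exposed by integral
-- functionals: the star face of σ (bases containing σ), the bases inside a
-- set U, and intersections of these.  The key geometric fact is
-- separating-face: two non-adjacent vertices of a face are separated by a
-- smaller face, so every edge of P_M joins adjacent bases (edge-adjacent).
-- The theorem then follows by the dimension d of P_M^*:
--   d ≥ 3: the shelling step at F_{β j}, applied to the face dual to the star
--          face of σ, yields an earlier vertex a on an edge {j, a} of P_M with
--          σ ⊆ β a (attached-dim≥3);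
--   d = 2: P_M is a triangle or a square, so two vertices are adjacent or span
--          P_M (polygon-dichotomy), and a polygon shelling attaches each edge of
--          P_M^* to an earlier one (attached-dim2);
--   d ≤ 1: P_M is a point or a segment.

open import Defs
open import Data.Nat as ℕ using (ℕ; zero; suc; _∸_; s≤s)
import Data.Nat.Properties as ℕP
open import Data.Integer as ℤ using (ℤ; +_; _+_; _≤_; _≤?_)
import Data.Integer.Properties as ℤP
open import Algebra.Properties.CommutativeSemigroup ℤP.+-commutativeSemigroup
  using (interchange; x∙yz≈y∙xz)
open import Data.Bool using (Bool; true; false; if_then_else_; _∧_; _∨_)
open import Data.Fin as Fin using (Fin; toℕ)
import Data.Fin.Properties as FP
open import Data.Fin.Properties using (any?; all?)
open import Data.Fin.Subset
open import Data.Fin.Subset.Properties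
open import Data.Vec using ([]; _∷_; here; there; lookup; tabulate)
import Data.Vec.Properties as VP
open import Data.List as List using (List; length; _∷_)
import Data.List.Membership.Propositional as LM
open import Data.List.Relation.Unary.Any using (here; there)
open import Data.Product using (∃; _×_; _,_; proj₁; proj₂)
open import Data.Sum using (_⊎_; inj₁; inj₂)
open import Data.Unit using (tt) renaming (⊤ to Unit)
open import Data.Empty using (⊥-elim)
open import Relation.Binary.PropositionalEquality
open import Relation.Nullary using (¬_; Dec; does; yes; no)
open import Relation.Nullary.Decidable using (_×-dec_; ¬?; dec-true)
open import Function using (_∘_)

+-cancelʳ-≤ : ∀ a b c → a + c ≤ b + c → a ≤ b
+-cancelʳ-≤ a b c a+c≤b+c with a ≤? b
... | yes a≤b = a≤b
... | no  a≰b = ⊥-elim (ℤP.<⇒≱ (ℤP.+-monoˡ-< c (ℤP.≰⇒> a≰b)) a+c≤b+c)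

+-cancelˡ-≤ : ∀ a b c → c + a ≤ c + b → a ≤ b
+-cancelˡ-≤ a b c h = +-cancelʳ-≤ a b c (subst₂ _≤_ (ℤP.+-comm c a) (ℤP.+-comm c b) h)

+-cancelʳ-≡ : ∀ a b c → a + c ≡ b + c → a ≡ b
+-cancelʳ-≡ a b c eq =
  ℤP.≤-antisym (+-cancelʳ-≤ a b c (ℤP.≤-reflexive eq)) (+-cancelʳ-≤ b a c (ℤP.≤-reflexive (sym eq)))

-- If A + B is at most a + b although a ≤ A and b ≤ B, then A ≤ a:
-- a common maximiser of a sum of two functions maximises each summand.
summand-≤ : ∀ {a A b B} → a ≤ A → b ≤ B → A + B ≤ a + b → A ≤ a
summand-≤ {a} {A} a≤A b≤B h with A ≤? a
... | yes A≤a = A≤a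
... | no  A≰a = ⊥-elim (ℤP.<⇒≱ (ℤP.+-mono-<-≤ (ℤP.≰⇒> A≰a) b≤B) h)

<⇒≤∸1 : ∀ {a b} → a ℕ.< b → a ℕ.≤ b ∸ 1
<⇒≤∸1 {b = suc b} (s≤s a≤b) = a≤b

∈-take : ∀ {A : Set} {x : A} r (xs : List A) → x LM.∈ List.take r xs → x LM.∈ xs
∈-take (suc r) (y ∷ ys) (here x≡y)  = here x≡y
∈-take (suc r) (y ∷ ys) (there x∈) = there (∈-take r ys x∈)

reindex-< : ∀ {m m'} {a b : Fin m} {a' b' : Fin m'} →
            toℕ a ≡ toℕ a' → toℕ b' ≡ toℕ b → a' Fin.< b' → a Fin.< b
reindex-< a≡a' b'≡b a'<b' = subst₂ ℕ._<_ (sym a≡a') b'≡b a'<b'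

module _ {n : ℕ} where

  ⊈-witness : {p q : Subset n} → ¬ (p ⊆ q) → ∃ λ x → x ∈ p × x ∉ q
  ⊈-witness {p} {q} p⊈q with any? (λ x → (x ∈? p) ×-dec ¬? (x ∈? q))
  ... | yes witness = witness
  ... | no  none    = ⊥-elim (p⊈q λ {x} → included x)
    where
    included : ∀ x → x ∈ p → x ∈ q
    included x x∈p with x ∈? q
    ... | yes x∈q = x∈q
    ... | no  x∉q = ⊥-elim (none (x , x∈p , x∉q))

  ⊆∧∣≥∣⇒≡ : {p q : Subset n} → p ⊆ q → ∣ q ∣ ℕ.≤ ∣ p ∣ → p ≡ q
  ⊆∧∣≥∣⇒≡ {p} {q} p⊆q ∣q∣≤∣p∣ with q ⊆? p
  ... | yes q⊆p = ⊆-antisym p⊆q q⊆p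
  ... | no  q⊈p with ⊈-witness q⊈p
  ... | x , x∈q , x∉p =
        ⊥-elim (ℕP.<⇒≱ (p⊂q⇒∣p∣<∣q∣ (p⊆q , x , x∈q , x∉p)) ∣q∣≤∣p∣)

  x∈p─q⁻ : {p q : Subset n} {x : Fin n} → x ∈ p ─ q → x ∈ p × x ∉ q
  x∈p─q⁻ {p} {q} x∈p─q = p─q⊆p p q x∈p─q , not-in p q x∈p─q
    where
    not-in : ∀ {m} (p q : Subset m) {x} → x ∈ p ─ q → x ∉ q
    not-in (_ ∷ p) (false ∷ q) here        ()
    not-in (_ ∷ p) (true  ∷ q) ()          here
    not-in (_ ∷ p) (_     ∷ q) (there x∈) (there x∈q) = not-in p q x∈ x∈q

  x∈p-y⁻ : {p : Subset n} {x y : Fin n} → x ∈ p - y → x ∈ p × x ≢ y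
  x∈p-y⁻ {y = y} x∈p-y with x∈p─q⁻ x∈p-y
  ... | x∈p , x∉⁅y⁆ = x∈p , λ x≡y → x∉⁅y⁆ (subst (_∈ ⁅ y ⁆) (sym x≡y) (x∈⁅x⁆ y))

  p-x⊆p : (p : Subset n) (x : Fin n) → p - x ⊆ p
  p-x⊆p p x = p─q⊆p p ⁅ x ⁆

  x∉p-x : {p : Subset n} (x : Fin n) → x ∉ p - x
  x∉p-x x x∈p-x = proj₂ (x∈p-y⁻ x∈p-x) refl

  x∈p∪⁅y⁆⁻ : {p : Subset n} {x y : Fin n} → x ∈ p ∪ ⁅ y ⁆ → x ∈ p ⊎ x ≡ y
  x∈p∪⁅y⁆⁻ {p} {y = y} x∈ with x∈p∪q⁻ p ⁅ y ⁆ x∈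
  ... | inj₁ x∈p = inj₁ x∈p
  ... | inj₂ x∈⁅y⁆ = inj₂ (x∈⁅y⁆⇒x≡y y x∈⁅y⁆)

  y∈p∪⁅y⁆ : {p : Subset n} (y : Fin n) → y ∈ p ∪ ⁅ y ⁆
  y∈p∪⁅y⁆ y = x∈p∪q⁺ (inj₂ (x∈⁅x⁆ y))

  ∈∧∉⇒≢ : {p : Subset n} {x y : Fin n} → x ∈ p → y ∉ p → x ≢ y
  ∈∧∉⇒≢ x∈p y∉p refl = y∉p x∈p

  ⁅x⁆⊆p : {p : Subset n} {x : Fin n} → x ∈ p → ⁅ x ⁆ ⊆ p
  ⁅x⁆⊆p {p} {x} x∈p y∈⁅x⁆ = subst (_∈ p) (sym (x∈⁅y⁆⇒x≡y x y∈⁅x⁆)) x∈p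

  p∩⁅y⁆≡⊥ : {p : Subset n} {y : Fin n} → y ∉ p → p ∩ ⁅ y ⁆ ≡ ⊥
  p∩⁅y⁆≡⊥ {p} {y} y∉p = ⊆-antisym disjoint (λ x∈⊥ → ⊥-elim (∉⊥ x∈⊥))
    where
    disjoint : p ∩ ⁅ y ⁆ ⊆ ⊥
    disjoint x∈ with x∈p∩q⁻ p ⁅ y ⁆ x∈
    ... | x∈p , x∈⁅y⁆ = ⊥-elim (y∉p (subst (_∈ p) (x∈⁅y⁆⇒x≡y y x∈⁅y⁆) x∈p))

  p-x∪⁅x⁆≡p : {p : Subset n} {x : Fin n} → x ∈ p → (p - x) ∪ ⁅ x ⁆ ≡ p
  p-x∪⁅x⁆≡p {p} {x} x∈p = ⊆-antisym ⊆p p⊆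
    where
    ⊆p : (p - x) ∪ ⁅ x ⁆ ⊆ p
    ⊆p e∈ with x∈p∪⁅y⁆⁻ e∈
    ... | inj₁ e∈p-x = p-x⊆p p x e∈p-x
    ... | inj₂ refl  = x∈p
    p⊆ : p ⊆ (p - x) ∪ ⁅ x ⁆
    p⊆ {e} e∈p with e Fin.≟ x
    ... | yes refl = y∈p∪⁅y⁆ x
    ... | no  e≢x  = x∈p∪q⁺ (inj₁ (x∈p∧x≢y⇒x∈p-y e∈p e≢x))

∣p∪⁅y⁆∣≡1+∣p∣ : ∀ {n} (p : Subset n) y → y ∉ p → ∣ p ∪ ⁅ y ⁆ ∣ ≡ suc ∣ p ∣
∣p∪⁅y⁆∣≡1+∣p∣ (true  ∷ p) Fin.zero    y∉p = ⊥-elim (y∉p here)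
∣p∪⁅y⁆∣≡1+∣p∣ (false ∷ p) Fin.zero    y∉p = cong (suc ∘ ∣_∣) (∪-identityʳ p)
∣p∪⁅y⁆∣≡1+∣p∣ (true  ∷ p) (Fin.suc y) y∉p = cong suc (∣p∪⁅y⁆∣≡1+∣p∣ p y (y∉p ∘ there))
∣p∪⁅y⁆∣≡1+∣p∣ (false ∷ p) (Fin.suc y) y∉p = ∣p∪⁅y⁆∣≡1+∣p∣ p y (y∉p ∘ there)

1+∣p-x∣≡∣p∣ : ∀ {n} (p : Subset n) x → x ∈ p → suc ∣ p - x ∣ ≡ ∣ p ∣
1+∣p-x∣≡∣p∣ (true  ∷ p) Fin.zero    x∈p         = cong (suc ∘ ∣_∣) (p─⊥≡p p)
1+∣p-x∣≡∣p∣ (true  ∷ p) (Fin.suc x) (there x∈p) = cong suc (1+∣p-x∣≡∣p∣ p x x∈p)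
1+∣p-x∣≡∣p∣ (false ∷ p) (Fin.suc x) (there x∈p) = 1+∣p-x∣≡∣p∣ p x x∈p

two-beyond : ∀ {n} {P A : Subset n} {e f} → P ⊆ A → e ∉ P → f ∉ P → e ≢ f →
             e ∈ A → f ∈ A → suc (suc ∣ P ∣) ℕ.≤ ∣ A ∣
two-beyond {P = P} {A} {e} {f} P⊆A e∉P f∉P e≢f e∈A f∈A =
  subst (ℕ._≤ ∣ A ∣) size (p⊆q⇒∣p∣≤∣q∣ ⊆A)
  where
  f∉P+e : f ∉ P ∪ ⁅ e ⁆
  f∉P+e f∈ with x∈p∪⁅y⁆⁻ f∈
  ... | inj₁ f∈P = f∉P f∈P
  ... | inj₂ f≡e = e≢f (sym f≡e)
  size : ∣ (P ∪ ⁅ e ⁆) ∪ ⁅ f ⁆ ∣ ≡ suc (suc ∣ P ∣)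
  size = trans (∣p∪⁅y⁆∣≡1+∣p∣ (P ∪ ⁅ e ⁆) f f∉P+e) (cong suc (∣p∪⁅y⁆∣≡1+∣p∣ P e e∉P))
  ⊆A : (P ∪ ⁅ e ⁆) ∪ ⁅ f ⁆ ⊆ A
  ⊆A x∈ with x∈p∪⁅y⁆⁻ x∈
  ... | inj₂ refl = f∈A
  ... | inj₁ x∈P+e with x∈p∪⁅y⁆⁻ x∈P+e
  ...   | inj₁ x∈P = P⊆A x∈P
  ...   | inj₂ refl = e∈A

ind : ∀ {n} → Subset n → Fin n → ℤ
ind S e = if lookup S e then + 1 else + 0

_⊕_ : ∀ {n} → (Fin n → ℤ) → (Fin n → ℤ) → Fin n → ℤ
(w₁ ⊕ w₂) e = w₁ e + w₂ e

weight-⊕ : ∀ {n} (w₁ w₂ : Fin n → ℤ) B → weight (w₁ ⊕ w₂) B ≡ weight w₁ B + weight w₂ B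
weight-⊕ w₁ w₂ []      = refl
weight-⊕ w₁ w₂ (b ∷ B) = begin
    (bit (w₁ ⊕ w₂) b) + weight ((w₁ ⊕ w₂) ∘ Fin.suc) B
  ≡⟨ cong₂ _+_ (split b) (weight-⊕ (w₁ ∘ Fin.suc) (w₂ ∘ Fin.suc) B) ⟩
    (bit w₁ b + bit w₂ b) + (weight (w₁ ∘ Fin.suc) B + weight (w₂ ∘ Fin.suc) B)
  ≡⟨ interchange (bit w₁ b) (bit w₂ b) _ _ ⟩
    (bit w₁ b + weight (w₁ ∘ Fin.suc) B) + (bit w₂ b + weight (w₂ ∘ Fin.suc) B) ∎
  where
  open ≡-Reasoning
  bit : ∀ {m} → (Fin (suc m) → ℤ) → Bool → ℤ
  bit w b = if b then w Fin.zero else + 0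
  split : ∀ b → bit (w₁ ⊕ w₂) b ≡ bit w₁ b + bit w₂ b
  split true  = refl
  split false = refl

weight-⊥ : ∀ {n} (w : Fin n → ℤ) → weight w ⊥ ≡ + 0
weight-⊥ {zero}  w = refl
weight-⊥ {suc n} w = trans (ℤP.+-identityˡ _) (weight-⊥ (w ∘ Fin.suc))

weight-⁅⁆ : ∀ {n} (w : Fin n → ℤ) y → weight w ⁅ y ⁆ ≡ w y
weight-⁅⁆ w Fin.zero    = trans (cong (λ t → w Fin.zero + t) (weight-⊥ (w ∘ Fin.suc))) (ℤP.+-identityʳ _)
weight-⁅⁆ w (Fin.suc y) = trans (ℤP.+-identityˡ _) (weight-⁅⁆ (w ∘ Fin.suc) y)

weight-∪∩ : ∀ {n} (w : Fin n → ℤ) A B →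
            weight w A + weight w B ≡ weight w (A ∪ B) + weight w (A ∩ B)
weight-∪∩ w []      []      = refl
weight-∪∩ {suc n} w (a ∷ A) (b ∷ B) = begin
    (bit a + weight w′ A) + (bit b + weight w′ B)
  ≡⟨ interchange (bit a) (weight w′ A) (bit b) (weight w′ B) ⟩
    (bit a + bit b) + (weight w′ A + weight w′ B)
  ≡⟨ cong₂ _+_ (bits a b) (weight-∪∩ w′ A B) ⟩
    (bit (a ∨ b) + bit (a ∧ b)) + (weight w′ (A ∪ B) + weight w′ (A ∩ B))
  ≡⟨ interchange (bit (a ∨ b)) (bit (a ∧ b)) _ _ ⟩
    (bit (a ∨ b) + weight w′ (A ∪ B)) + (bit (a ∧ b) + weight w′ (A ∩ B)) ∎
  where
  open ≡-Reasoning
  w′ : Fin n → ℤ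
  w′ = w ∘ Fin.suc
  bit : Bool → ℤ
  bit b = if b then w Fin.zero else + 0
  bits : ∀ a b → bit a + bit b ≡ bit (a ∨ b) + bit (a ∧ b)
  bits true  true  = refl
  bits true  false = refl
  bits false true  = ℤP.+-comm (+ 0) (w Fin.zero)
  bits false false = refl

weight-ind : ∀ {n} (S B : Subset n) → weight (ind S) B ≡ + ∣ B ∩ S ∣
weight-ind []           []           = refl
weight-ind (true  ∷ S) (true  ∷ B) = cong (λ t → + 1 + t) (weight-ind S B)
weight-ind (false ∷ S) (true  ∷ B) = trans (ℤP.+-identityˡ _) (weight-ind S B)
weight-ind (_     ∷ S) (false ∷ B) = trans (ℤP.+-identityˡ _) (weight-ind S B)

weight-∪⁅⁆ : ∀ {n} (w : Fin n → ℤ) (A : Subset n) y → y ∉ A →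
             weight w (A ∪ ⁅ y ⁆) ≡ weight w A + w y
weight-∪⁅⁆ w A y y∉A = begin
    weight w (A ∪ ⁅ y ⁆)
  ≡⟨ sym (ℤP.+-identityʳ _) ⟩
    weight w (A ∪ ⁅ y ⁆) + + 0
  ≡⟨ cong (λ Z → weight w (A ∪ ⁅ y ⁆) + Z) (sym (trans (cong (weight w) (p∩⁅y⁆≡⊥ y∉A)) (weight-⊥ w))) ⟩
    weight w (A ∪ ⁅ y ⁆) + weight w (A ∩ ⁅ y ⁆)
  ≡⟨ sym (weight-∪∩ w A ⁅ y ⁆) ⟩
    weight w A + weight w ⁅ y ⁆
  ≡⟨ cong (λ t → weight w A + t) (weight-⁅⁆ w y) ⟩
    weight w A + w y ∎
  where open ≡-Reasoning

weight-exchange : ∀ {n} (w : Fin n → ℤ) (A : Subset n) x y → x ∈ A → y ∉ A →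
                  weight w ((A - x) ∪ ⁅ y ⁆) + w x ≡ weight w A + w y
weight-exchange w A x y x∈A y∉A = begin
    weight w ((A - x) ∪ ⁅ y ⁆) + w x
  ≡⟨ cong (_+ w x) (weight-∪⁅⁆ w (A - x) y (y∉A ∘ p-x⊆p A x)) ⟩
    (weight w (A - x) + w y) + w x
  ≡⟨ ℤP.+-assoc (weight w (A - x)) (w y) (w x) ⟩
    weight w (A - x) + (w y + w x)
  ≡⟨ cong (λ t → weight w (A - x) + t) (ℤP.+-comm (w y) (w x)) ⟩
    weight w (A - x) + (w x + w y)
  ≡⟨ sym (ℤP.+-assoc (weight w (A - x)) (w x) (w y)) ⟩
    (weight w (A - x) + w x) + w y
  ≡⟨ cong (_+ w y) (sym (weight-∪⁅⁆ w (A - x) x (x∉p-x x))) ⟩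
    weight w ((A - x) ∪ ⁅ x ⁆) + w y
  ≡⟨ cong (λ Z → weight w Z + w y) (p-x∪⁅x⁆≡p x∈A) ⟩
    weight w A + w y ∎
  where open ≡-Reasoning

argmin : ∀ {n} (P : Fin n → Set) → (∀ x → Dec (P x)) → (f : Fin n → ℤ) → ∃ P →
         ∃ λ x → P x × (∀ z → P z → f x ≤ f z)
argmin {zero}  P P? f (() , _)
argmin {suc n} P P? f (x₀ , px₀) with any? (λ z → P? (Fin.suc z))
... | no none = Fin.zero , at-zero x₀ px₀ , λ { Fin.zero _ → ℤP.≤-refl
                                              ; (Fin.suc z) pz → ⊥-elim (none (z , pz)) }
  where
  at-zero : ∀ x → P x → P Fin.zero
  at-zero Fin.zero    p = p
  at-zero (Fin.suc z) p = ⊥-elim (none (z , p))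
... | yes some with argmin (P ∘ Fin.suc) (P? ∘ Fin.suc) (f ∘ Fin.suc) some | P? Fin.zero
... | x , px , min | no ¬p0 = Fin.suc x , px , λ { Fin.zero p → ⊥-elim (¬p0 p)
                                               ; (Fin.suc z) p → min z p }
... | x , px , min | yes p0 with f Fin.zero ≤? f (Fin.suc x)
...   | yes le = Fin.zero , p0 , λ { Fin.zero _ → ℤP.≤-refl
                                   ; (Fin.suc z) p → ℤP.≤-trans le (min z p) }
...   | no  gt = Fin.suc x , px , λ { Fin.zero _ → ℤP.<⇒≤ (ℤP.≰⇒> gt)
                                    ; (Fin.suc z) p → min z p }

module _ {A B : Set} (f : A → B) where

  entry-at : ∀ {m} (g : Fin m → A) (i : Fin (length (List.map f (List.tabulate g)))) →
             ∃ λ a → List.lookup (List.map f (List.tabulate g)) i ≡ f (g a) × toℕ a ≡ toℕ i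
  entry-at {suc m} g Fin.zero    = Fin.zero , refl , refl
  entry-at {suc m} g (Fin.suc i) with entry-at (g ∘ Fin.suc) i
  ... | a , eq , same = Fin.suc a , eq , cong suc same

  position-of : ∀ {m} (g : Fin m → A) (a : Fin m) →
                ∃ λ (i : Fin (length (List.map f (List.tabulate g)))) →
                  List.lookup (List.map f (List.tabulate g)) i ≡ f (g a) × toℕ i ≡ toℕ a
  position-of g Fin.zero    = Fin.zero , refl , refl
  position-of g (Fin.suc a) with position-of (g ∘ Fin.suc) a
  ... | i , eq , same = Fin.suc i , eq , cong suc same

module MatroidPolytope {n : ℕ} (M : Matroid n) {k : ℕ} (β : Fin k → Subset n)
                       (order : BasisOrder M k β) where
  open Matroid M
  open BasisOrder order

  indep-≤-basis : ∀ {B J} → IsBasis B → Indep J → ∣ J ∣ ℕ.≤ ∣ B ∣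
  indep-≤-basis {B} {J} (indep-B , maximal) indep-J with ∣ J ∣ ℕ.≤? ∣ B ∣
  ... | yes ≤ = ≤
  ... | no  ≰ with augment indep-B indep-J (ℕP.≰⇒> ≰)
  ... | x , _ , x∉B , indep-B+x = ⊥-elim (x∉B (subst (x ∈_) B+x≡B (y∈p∪⁅y⁆ x)))
    where
    B+x≡B : B ∪ ⁅ x ⁆ ≡ B
    B+x≡B = maximal _ indep-B+x (p⊆p∪q ⁅ x ⁆)

  rank-β : ∀ c d → ∣ β c ∣ ≡ ∣ β d ∣
  rank-β c d = ℕP.≤-antisym (indep-≤-basis (β-basis d) (proj₁ (β-basis c)))
                            (indep-≤-basis (β-basis c) (proj₁ (β-basis d)))

  full-rank-basis : ∀ {B I} → IsBasis B → Indep I → ∣ B ∣ ℕ.≤ ∣ I ∣ → IsBasis I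
  full-rank-basis {B} {I} basis-B indep-I ∣B∣≤∣I∣ = indep-I , λ J indep-J I⊆J →
    sym (⊆∧∣≥∣⇒≡ I⊆J (ℕP.≤-trans (indep-≤-basis basis-B indep-J) ∣B∣≤∣I∣))

  β-⊆-injective : ∀ {i j} → β i ⊆ β j → i ≡ j
  β-⊆-injective {i} {j} βi⊆βj =
    β-inj i j (sym (proj₂ (β-basis i) (β j) (proj₁ (β-basis j)) βi⊆βj))

  exchange : ∀ {a b x} → x ∈ β a → x ∉ β b →
             ∃ λ y → y ∈ β b × y ∉ β a × ∃ λ c → β c ≡ (β a - x) ∪ ⁅ y ⁆
  exchange {a} {b} {x} x∈a x∉b
    with augment (indep-⊆ (p-x⊆p (β a) x) (proj₁ (β-basis a))) (proj₁ (β-basis b))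
                 (subst (∣ β a - x ∣ ℕ.<_) (rank-β a b) (x∈p⇒∣p-x∣<∣p∣ x∈a))
  ... | y , y∈b , y∉a-x , indep = y , y∈b , y∉a , β-onto _ (full-rank-basis (β-basis a) indep full)
    where
    y∉a : y ∉ β a
    y∉a y∈a with y Fin.≟ x
    ... | yes refl = x∉b y∈b
    ... | no  y≢x  = y∉a-x (x∈p∧x≢y⇒x∈p-y y∈a y≢x)
    full : ∣ β a ∣ ℕ.≤ ∣ (β a - x) ∪ ⁅ y ⁆ ∣
    full = ℕP.≤-reflexive (trans (sym (1+∣p-x∣≡∣p∣ (β a) x x∈a))
                                 (sym (∣p∪⁅y⁆∣≡1+∣p∣ (β a - x) y y∉a-x)))

  -- Adjacency of bases: β i ∖ β j is a single element x.  These pairs are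
  -- exactly the edges of the matroid polytope.
  Adj : Fin k → Fin k → Set
  Adj i j = ∃ λ x → x ∈ β i × x ∉ β j × (β i - x) ⊆ β j

  -- all bases pairwise adjacent (P_M is a simplex)
  AllAdj : Set
  AllAdj = ∀ a b → a ≢ b → Adj a b

  adjacent-or-two-apart : ∀ {a b} → a ≢ b →
    Adj a b ⊎ (∃ λ e → ∃ λ f → e ≢ f × e ∈ β a × f ∈ β a × e ∉ β b × f ∉ β b)
  adjacent-or-two-apart a≢b with ⊈-witness (a≢b ∘ β-⊆-injective)
  ... | e , e∈a , e∉b with (_ - e) ⊆? _
  ...   | yes a-e⊆b = inj₁ (e , e∈a , e∉b , a-e⊆b)
  ...   | no  a-e⊈b with ⊈-witness a-e⊈b
  ...     | f , f∈a-e , f∉b with x∈p-y⁻ f∈a-e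
  ...       | f∈a , f≢e = inj₂ (e , f , f≢e ∘ sym , e∈a , f∈a , e∉b , f∉b)

  no-room : ∀ {m} → suc (suc m) ℕ.≤ suc m → ∀ {A : Set} → A
  no-room 2+m≤1+m = ⊥-elim (ℕP.<-irrefl refl 2+m≤1+m)

  -- adjacency is symmetric since all bases have the same size
  Adj-sym : ∀ {a b} → Adj a b → Adj b a
  Adj-sym {a} {b} (x , x∈a , x∉b , a-x⊆b) with adjacent-or-two-apart b≢a
    where
    b≢a : b ≢ a
    b≢a refl = x∉b x∈a
  ... | inj₁ adj = adj
  ... | inj₂ (e , f , e≢f , e∈b , f∈b , e∉a , f∉a) = no-room (begin
      suc (suc ∣ β a - x ∣) ≤⟨ two-beyond a-x⊆b (e∉a ∘ p-x⊆p (β a) x) (f∉a ∘ p-x⊆p (β a) x)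
                                           e≢f e∈b f∈b ⟩
      ∣ β b ∣                ≡⟨ rank-β b a ⟩
      ∣ β a ∣                ≡⟨ sym (1+∣p-x∣≡∣p∣ (β a) x x∈a) ⟩
      suc ∣ β a - x ∣        ∎)
    where open ℕP.≤-Reasoning

  common-corank-one⇒AllAdj : ∀ {C t} → (∀ c → C ⊆ β c) → suc ∣ C ∣ ≡ ∣ β t ∣ → AllAdj
  common-corank-one⇒AllAdj {C} {t} C⊆β ∣C∣+1≡r a b a≢b with adjacent-or-two-apart a≢b
  ... | inj₁ adj = adj
  ... | inj₂ (e , f , e≢f , e∈a , f∈a , e∉b , f∉b) = no-room (begin
      suc (suc ∣ C ∣) ≤⟨ two-beyond (C⊆β a) (e∉b ∘ C⊆β b) (f∉b ∘ C⊆β b) e≢f e∈a f∈a ⟩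
      ∣ β a ∣          ≡⟨ rank-β a t ⟩
      ∣ β t ∣          ≡⟨ sym ∣C∣+1≡r ⟩
      suc ∣ C ∣        ∎)
    where open ℕP.≤-Reasoning

  common-small-superset⇒AllAdj : ∀ {U t} → (∀ c → β c ⊆ U) → ∣ U ∣ ℕ.≤ suc ∣ β t ∣ → AllAdj
  common-small-superset⇒AllAdj {U} {t} β⊆U ∣U∣≤r+1 a b a≢b with adjacent-or-two-apart a≢b
  ... | inj₁ adj = adj
  ... | inj₂ (e , f , e≢f , e∈a , f∈a , e∉b , f∉b) = no-room (begin
      suc (suc ∣ β b ∣) ≤⟨ two-beyond (β⊆U b) e∉b f∉b e≢f (β⊆U a e∈a) (β⊆U a f∈a) ⟩
      ∣ U ∣              ≤⟨ ∣U∣≤r+1 ⟩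
      suc ∣ β t ∣        ≡⟨ cong suc (rank-β t b) ⟩
      suc ∣ β b ∣        ∎)
    where open ℕP.≤-Reasoning

  two-vertices⇒AllAdj : ∀ {t s} → Adj t s → (∀ c → c ≡ t ⊎ c ≡ s) → AllAdj
  two-vertices⇒AllAdj adj t-or-s a b a≢b with t-or-s a | t-or-s b
  ... | inj₁ refl | inj₁ refl = ⊥-elim (a≢b refl)
  ... | inj₁ refl | inj₂ refl = adj
  ... | inj₂ refl | inj₁ refl = Adj-sym adj
  ... | inj₂ refl | inj₂ refl = ⊥-elim (a≢b refl)

  between-adjacent : ∀ {t s u x} → x ∈ β t → (β t - x) ⊆ β s →
                     (β t - x) ⊆ β u → β u ⊆ β t ∪ β s → u ≡ t ⊎ u ≡ s
  between-adjacent {t} {s} {u} {x} x∈t t-x⊆s t-x⊆u u⊆t∪s with β u ⊆? β s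
  ... | yes u⊆s = inj₂ (β-⊆-injective u⊆s)
  ... | no  u⊈s with ⊈-witness u⊈s
  ... | e , e∈u , e∉s = inj₁ (sym (β-⊆-injective t⊆u))
    where
    e≡x : e ≡ x
    e≡x with x∈p∪q⁻ (β t) (β s) (u⊆t∪s e∈u)
    ... | inj₂ e∈s = ⊥-elim (e∉s e∈s)
    ... | inj₁ e∈t with e Fin.≟ x
    ...   | yes e≡x = e≡x
    ...   | no  e≢x = ⊥-elim (e∉s (t-x⊆s (x∈p∧x≢y⇒x∈p-y e∈t e≢x)))
    t⊆u : β t ⊆ β u
    t⊆u {f} f∈t with f Fin.≟ x
    ... | yes refl = subst (_∈ β u) e≡x e∈u
    ... | no  f≢x  = t-x⊆u (x∈p∧x≢y⇒x∈p-y f∈t f≢x)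

  -- Faces of the matroid polytope P_M.  Vertex i is χ_{β i}; the face exposed
  -- by an integral functional w is the set of vertices maximising W w.

  W : (Fin n → ℤ) → Fin k → ℤ
  W w i = weight w (β i)

  Maximises : (Fin n → ℤ) → Fin k → Set
  Maximises w i = ∀ j → W w j ≤ W w i

  maximises? : ∀ w i → Dec (Maximises w i)
  maximises? w i = all? (λ j → W w j ≤? W w i)

  face : (Fin n → ℤ) → Subset k
  face w = tabulate (λ i → does (maximises? w i))

  ∈face⁺ : ∀ w {i} → Maximises w i → i ∈ face w
  ∈face⁺ w {i} max = VP.lookup⇒[]= i (face w)
    (trans (VP.lookup∘tabulate (λ j → does (maximises? w j)) i) (dec-true (maximises? w i) max))

  ∈face⁻ : ∀ w {i} → i ∈ face w → Maximises w i
  ∈face⁻ w {i} i∈ = from-true (maximises? w i) chosen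
    where
    from-true : ∀ {P : Set} (d : Dec P) → does d ≡ true → P
    from-true (yes p) _ = p
    from-true (no  _) ()
    chosen : does (maximises? w i) ≡ true
    chosen = trans (sym (VP.lookup∘tabulate (λ j → does (maximises? w j)) i)) (VP.[]=⇒lookup i∈)

  face-isFace : ∀ w → IsFace β (face w)
  face-isFace w = inj₂ (w , λ i → ∈face⁻ w , ∈face⁺ w)

  exposing : ∀ {X j} → IsFace β X → j ∈ X →
             ∃ λ w → (∀ {i} → i ∈ X → Maximises w i) × (∀ {i} → Maximises w i → i ∈ X)
  exposing (inj₁ refl)   j∈⊥ = ⊥-elim (∉⊥ j∈⊥)
  exposing (inj₂ (w , X≈)) _ = w , (λ {i} → proj₁ (X≈ i)) , (λ {i} → proj₂ (X≈ i))

  W-ind : ∀ S c → W (ind S) c ≡ + ∣ β c ∩ S ∣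
  W-ind S c = weight-ind S (β c)

  star-max : ∀ {S p} → S ⊆ β p → ∀ {c} →
             (Maximises (ind S) c → S ⊆ β c) × (S ⊆ β c → Maximises (ind S) c)
  star-max {S} {p} S⊆p {c} = to , from
    where
    ∣S∣≤ : ∀ {d} → S ⊆ β d → ∣ S ∣ ℕ.≤ ∣ β d ∩ S ∣
    ∣S∣≤ S⊆d = p⊆q⇒∣p∣≤∣q∣ (λ e∈S → x∈p∩q⁺ (S⊆d e∈S , e∈S))
    to : Maximises (ind S) c → S ⊆ β c
    to max e∈S = proj₁ (x∈p∩q⁻ (β c) S (subst (_ ∈_) (sym c∩S≡S) e∈S))
      where
      c∩S≡S : β c ∩ S ≡ S
      c∩S≡S = ⊆∧∣≥∣⇒≡ (p∩q⊆q (β c) S)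
        (ℕP.≤-trans (∣S∣≤ S⊆p) (ℤP.drop‿+≤+ (subst₂ _≤_ (W-ind S p) (W-ind S c) (max p))))
    from : S ⊆ β c → Maximises (ind S) c
    from S⊆c d = subst₂ _≤_ (sym (W-ind S d)) (sym (W-ind S c))
                   (ℤ.+≤+ (ℕP.≤-trans (∣p∩q∣≤∣q∣ (β d) S) (∣S∣≤ S⊆c)))

  inside-max : ∀ {U p} → β p ⊆ U → ∀ {c} →
               (Maximises (ind U) c → β c ⊆ U) × (β c ⊆ U → Maximises (ind U) c)
  inside-max {U} {p} p⊆U {c} = to , from
    where
    r≤ : ∀ {d} → β d ⊆ U → ∣ β d ∣ ℕ.≤ ∣ β d ∩ U ∣
    r≤ d⊆U = p⊆q⇒∣p∣≤∣q∣ (λ e∈d → x∈p∩q⁺ (e∈d , d⊆U e∈d))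
    to : Maximises (ind U) c → β c ⊆ U
    to max e∈c = proj₂ (x∈p∩q⁻ (β c) U (subst (_ ∈_) (sym c∩U≡c) e∈c))
      where
      c∩U≡c : β c ∩ U ≡ β c
      c∩U≡c = ⊆∧∣≥∣⇒≡ (p∩q⊆p (β c) U)
        (ℕP.≤-trans (ℕP.≤-reflexive (rank-β c p))
          (ℕP.≤-trans (r≤ p⊆U) (ℤP.drop‿+≤+ (subst₂ _≤_ (W-ind U p) (W-ind U c) (max p)))))
    from : β c ⊆ U → Maximises (ind U) c
    from c⊆U d = subst₂ _≤_ (sym (W-ind U d)) (sym (W-ind U c))
      (ℤ.+≤+ (ℕP.≤-trans (∣p∩q∣≤∣p∣ (β d) U)
                (ℕP.≤-trans (ℕP.≤-reflexive (rank-β d c)) (r≤ c⊆U))))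

  star⁺ : ∀ {S p} → S ⊆ β p → ∀ {c} → S ⊆ β c → c ∈ face (ind S)
  star⁺ S⊆p S⊆c = ∈face⁺ _ (proj₂ (star-max S⊆p) S⊆c)

  star⁻ : ∀ {S p} → S ⊆ β p → ∀ {c} → c ∈ face (ind S) → S ⊆ β c
  star⁻ S⊆p c∈ = proj₁ (star-max S⊆p) (∈face⁻ _ c∈)

  inside⁺ : ∀ {U p} → β p ⊆ U → ∀ {c} → β c ⊆ U → c ∈ face (ind U)
  inside⁺ p⊆U c⊆U = ∈face⁺ _ (proj₂ (inside-max p⊆U) c⊆U)

  inside⁻ : ∀ {U p} → β p ⊆ U → ∀ {c} → c ∈ face (ind U) → β c ⊆ U
  inside⁻ p⊆U c∈ = proj₁ (inside-max p⊆U) (∈face⁻ _ c∈)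

  meet-max : ∀ w₁ w₂ {p} → Maximises w₁ p → Maximises w₂ p → ∀ {c} →
             (Maximises (w₁ ⊕ w₂) c → Maximises w₁ c × Maximises w₂ c) ×
             (Maximises w₁ c × Maximises w₂ c → Maximises (w₁ ⊕ w₂) c)
  meet-max w₁ w₂ {p} max₁ max₂ {c} = to , from
    where
    split : ∀ t → W (w₁ ⊕ w₂) t ≡ W w₁ t + W w₂ t
    split t = weight-⊕ w₁ w₂ (β t)
    to : Maximises (w₁ ⊕ w₂) c → Maximises w₁ c × Maximises w₂ c
    to max = (λ s → ℤP.≤-trans (max₁ s) p≤c₁) , (λ s → ℤP.≤-trans (max₂ s) p≤c₂)
      where
      sum≤ : W w₁ p + W w₂ p ≤ W w₁ c + W w₂ c
      sum≤ = subst₂ _≤_ (split p) (split c) (max p)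
      p≤c₁ : W w₁ p ≤ W w₁ c
      p≤c₁ = summand-≤ (max₁ c) (max₂ c) sum≤
      p≤c₂ : W w₂ p ≤ W w₂ c
      p≤c₂ = summand-≤ (max₂ c) (max₁ c)
               (subst₂ _≤_ (ℤP.+-comm (W w₁ p) _) (ℤP.+-comm (W w₁ c) _) sum≤)
    from : Maximises w₁ c × Maximises w₂ c → Maximises (w₁ ⊕ w₂) c
    from (c₁ , c₂) s = subst₂ _≤_ (sym (split s)) (sym (split c)) (ℤP.+-mono-≤ (c₁ s) (c₂ s))

  balanced-pair : ∀ {a b a' b'} → (∀ w → W w a + W w b ≡ W w a' + W w b') →
                  ∀ {K} → IsFace β K → a ∈ K → b ∈ K → a' ∈ K × b' ∈ K
  balanced-pair {a} {b} {a'} {b'} balanced K-face a∈K b∈K with exposing K-face a∈K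
  ... | w , max , ∈K = ∈K (λ d → ℤP.≤-trans (max a∈K d) a≤a') ,
                       ∈K (λ d → ℤP.≤-trans (max b∈K d) b≤b')
    where
    a≤a' : W w a ≤ W w a'
    a≤a' = summand-≤ (max a∈K a') (max b∈K b') (ℤP.≤-reflexive (balanced w))
    b≤b' : W w b ≤ W w b'
    b≤b' = summand-≤ (max b∈K b') (max a∈K a')
      (ℤP.≤-reflexive (trans (ℤP.+-comm (W w b) _) (trans (balanced w) (ℤP.+-comm (W w a') _))))

  restrict-star : ∀ w {S p} → Maximises w p → S ⊆ β p → ∀ {c} →
    (Maximises (w ⊕ ind S) c → Maximises w c × S ⊆ β c) ×
    (Maximises w c × S ⊆ β c → Maximises (w ⊕ ind S) c)
  restrict-star w {S} {p} max-p S⊆p =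
    (λ max → let c₁ , c₂ = proj₁ (meet-max w (ind S) max-p S-max) max in
             c₁ , proj₁ (star-max S⊆p) c₂) ,
    (λ { (c₁ , S⊆c) → proj₂ (meet-max w (ind S) max-p S-max) (c₁ , proj₂ (star-max S⊆p) S⊆c) })
    where
    S-max : Maximises (ind S) p
    S-max = proj₂ (star-max S⊆p) S⊆p

  restrict-inside : ∀ w {U p} → Maximises w p → β p ⊆ U → ∀ {c} →
    (Maximises (w ⊕ ind U) c → Maximises w c × β c ⊆ U) ×
    (Maximises w c × β c ⊆ U → Maximises (w ⊕ ind U) c)
  restrict-inside w {U} {p} max-p p⊆U =
    (λ max → let c₁ , c₂ = proj₁ (meet-max w (ind U) max-p U-max) max in
             c₁ , proj₁ (inside-max p⊆U) c₂) ,
    (λ { (c₁ , c⊆U) → proj₂ (meet-max w (ind U) max-p U-max) (c₁ , proj₂ (inside-max p⊆U) c⊆U) })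
    where
    U-max : Maximises (ind U) p
    U-max = proj₂ (inside-max p⊆U) p⊆U

  cheapest-exchange : ∀ {w j i x} → Maximises w j → Maximises w i →
    x ∈ β j → x ∉ β i → (∀ z → z ∈ β j × z ∉ β i → w x ≤ w z) →
    ∃ λ y → y ∉ β j × ∃ λ m → β m ≡ (β j - x) ∪ ⁅ y ⁆ × Maximises w m
  cheapest-exchange {w} {j} {i} {x} max-j max-i x∈j x∉i cheapest with exchange x∈j x∉i
  ... | y , y∈i , y∉j , m , βm with exchange y∈i y∉j
  ... | x' , x'∈j , x'∉i , m' , βm' = y , y∉j , m , βm , λ d → ℤP.≤-trans (max-j d) j≤m
    where
    -- the reverse exchange cannot beat the maximal β i
    x'≤y : w x' ≤ w y
    x'≤y = +-cancelˡ-≤ (w x') (w y) (W w i) (begin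
      W w i + w x'                        ≡⟨ sym (weight-exchange w (β i) y x' y∈i x'∉i) ⟩
      weight w ((β i - y) ∪ ⁅ x' ⁆) + w y ≡⟨ cong (λ B → weight w B + w y) (sym βm') ⟩
      W w m' + w y                        ≤⟨ ℤP.+-monoˡ-≤ (w y) (max-i m') ⟩
      W w i + w y                         ∎)
      where open ℤP.≤-Reasoning
    j≤m : W w j ≤ W w m
    j≤m = +-cancelʳ-≤ (W w j) (W w m) (w x) (begin
      W w j + w x                        ≤⟨ ℤP.+-monoʳ-≤ (W w j)
                                              (ℤP.≤-trans (cheapest x' (x'∈j , x'∉i)) x'≤y) ⟩
      W w j + w y                        ≡⟨ sym (weight-exchange w (β j) x y x∈j y∉j) ⟩
      weight w ((β j - x) ∪ ⁅ y ⁆) + w x ≡⟨ cong (λ B → weight w B + w x) (sym βm) ⟩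
      W w m + w x                        ∎)
      where open ℤP.≤-Reasoning

  -- Key fact: two non-adjacent vertices j, i of a face X are separated by a
  -- smaller face Y ⊆ X containing j and another vertex but not i.
  -- Hence every edge of P_M joins adjacent bases.
  separating-face : ∀ {X j i} → IsFace β X → j ∈ X → i ∈ X → i ≢ j →
    Adj j i ⊎ (∃ λ Y → IsFace β Y × j ∈ Y × (∃ λ m → m ∈ Y × m ≢ j) × Y ⊆ X × i ∉ Y)
  separating-face {X} {j} {i} X-face j∈X i∈X i≢j with exposing X-face j∈X
  ... | w , max , ∈X
    with argmin (λ x → x ∈ β j × x ∉ β i) (λ x → (x ∈? β j) ×-dec ¬? (x ∈? β i)) w
                (⊈-witness (λ j⊆i → i≢j (sym (β-⊆-injective j⊆i))))
  ... | x , (x∈j , x∉i) , cheapest with (β j - x) ⊆? β i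
  ...   | yes j-x⊆i = inj₁ (x , x∈j , x∉i , j-x⊆i)
  ...   | no  j-x⊈i with cheapest-exchange (max j∈X) (max i∈X) x∈j x∉i cheapest
  ...     | y , y∉j , m , βm , max-m =
            inj₂ (face u , face-isFace u , in-Y (max j∈X) T⊆j , (m , in-Y max-m T⊆m , m≢j) ,
                  (λ c∈Y → ∈X (proj₁ (from-Y c∈Y))) , (λ i∈Y → j-x⊈i (proj₂ (from-Y i∈Y))))
    where
    T : Subset n
    T = β j - x
    u : Fin n → ℤ
    u = w ⊕ ind T
    T⊆j : T ⊆ β j
    T⊆j = p-x⊆p (β j) x
    in-Y : ∀ {c} → Maximises w c → T ⊆ β c → c ∈ face u
    in-Y max-c T⊆c = ∈face⁺ u (proj₂ (restrict-star w (max j∈X) T⊆j) (max-c , T⊆c))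
    from-Y : ∀ {c} → c ∈ face u → Maximises w c × T ⊆ β c
    from-Y c∈Y = proj₁ (restrict-star w (max j∈X) T⊆j) (∈face⁻ u c∈Y)
    T⊆m : T ⊆ β m
    T⊆m e∈T = subst (_ ∈_) (sym βm) (x∈p∪q⁺ (inj₁ e∈T))
    m≢j : m ≢ j
    m≢j refl with x∈p∪⁅y⁆⁻ (subst (x ∈_) βm x∈j)
    ... | inj₁ x∈T  = x∉p-x x x∈T
    ... | inj₂ refl = y∉j x∈j

  fills-cover : ∀ {G X Z} → Covers β G X → IsFace β Z → G ⊆ Z →
                (∃ λ m → m ∈ Z × m ∉ G) → Z ⊆ X → X ⊆ Z
  fills-cover (_ , _ , _ , nothing-between) Z-face G⊆Z G⊂Z Z⊆X {c} c∈X with c ∈? _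
  ... | yes c∈Z = c∈Z
  ... | no  c∉Z = ⊥-elim (nothing-between _ Z-face (G⊆Z , G⊂Z) (Z⊆X , c , c∈X , c∉Z))

  -- The faces covering ⊥ are the vertices {t}: the star face of β t is {t}.
  vertex : ∀ {G} → Covers β ⊥ G → ∃ λ t → G ≡ ⁅ t ⁆
  vertex {G} cover@(_ , _ , (_ , t , t∈G , _) , _) = t , ⊆-antisym G⊆t (⁅x⁆⊆p t∈G)
    where
    star-t : face (ind (β t)) ⊆ ⁅ t ⁆
    star-t c∈ = subst (_∈ ⁅ t ⁆) (β-⊆-injective (star⁻ {p = t} (λ e → e) c∈)) (x∈⁅x⁆ t)
    t-star : t ∈ face (ind (β t))
    t-star = star⁺ {p = t} (λ e → e) (λ e → e)
    G⊆t : G ⊆ ⁅ t ⁆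
    G⊆t = star-t ∘ fills-cover cover (face-isFace _) (⊆-min _) (t , t-star , ∉⊥)
                                (⊆-trans star-t (⁅x⁆⊆p t∈G))

  edge-adjacent : ∀ {t X a} → Covers β ⁅ t ⁆ X → a ∈ X → a ≢ t → Adj t a
  edge-adjacent {t} cover@(_ , X-face , (t⊆X , _) , _) a∈X a≢t
    with separating-face X-face (t⊆X (x∈⁅x⁆ t)) a∈X a≢t
  ... | inj₁ adj = adj
  ... | inj₂ (Y , Y-face , t∈Y , (m , m∈Y , m≢t) , Y⊆X , a∉Y) =
        ⊥-elim (a∉Y (fills-cover cover Y-face (⁅x⁆⊆p t∈Y) (m , m∈Y , m≢t ∘ x∈⁅y⁆⇒x≡y t) Y⊆X a∈X))

  record Edge (t : Fin k) (X : Subset k) : Set where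
    field
      s        : Fin k
      s∈X      : s ∈ X
      s≢t      : s ≢ t
      x        : Fin n
      x∈t      : x ∈ β t
      x∉s      : x ∉ β s
      t-x⊆s    : (β t - x) ⊆ β s
      vertices : ∀ {u} → u ∈ X → u ≡ t ⊎ u ≡ s

  edge : ∀ {t X} → Covers β ⁅ t ⁆ X → Edge t X
  edge {t} {X} cover@(_ , X-face , (t⊆X , s , s∈X , s∉t) , _)
    with edge-adjacent cover s∈X (x∉⁅y⁆⇒x≢y s∉t) | exposing X-face (t⊆X (x∈⁅x⁆ t))
  ... | x , x∈t , x∉s , t-x⊆s | w , max , ∈X = record
    { s = s ; s∈X = s∈X ; s≢t = x∉⁅y⁆⇒x≢y s∉t
    ; x = x ; x∈t = x∈t ; x∉s = x∉s ; t-x⊆s = t-x⊆s ; vertices = vertices }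
    where
    t∈X : t ∈ X
    t∈X = t⊆X (x∈⁅x⁆ t)
    C U : Subset n
    C = β t - x
    U = β t ∪ β s
    fills : ∀ {Z} → IsFace β Z → t ∈ Z → s ∈ Z → Z ⊆ X → X ⊆ Z
    fills Z-face t∈Z s∈Z = fills-cover cover Z-face (⁅x⁆⊆p t∈Z) (s , s∈Z , s∉t)
    X∩star : ∀ {c} → c ∈ face (w ⊕ ind C) → Maximises w c × C ⊆ β c
    X∩star c∈ = proj₁ (restrict-star w (max t∈X) (p-x⊆p (β t) x)) (∈face⁻ _ c∈)
    X∩star⁺ : ∀ {c} → c ∈ X → C ⊆ β c → c ∈ face (w ⊕ ind C)
    X∩star⁺ c∈X C⊆c = ∈face⁺ _ (proj₂ (restrict-star w (max t∈X) (p-x⊆p (β t) x)) (max c∈X , C⊆c))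
    X∩inside : ∀ {c} → c ∈ face (w ⊕ ind U) → Maximises w c × β c ⊆ U
    X∩inside c∈ = proj₁ (restrict-inside w (max t∈X) (p⊆p∪q (β s))) (∈face⁻ _ c∈)
    X∩inside⁺ : ∀ {c} → c ∈ X → β c ⊆ U → c ∈ face (w ⊕ ind U)
    X∩inside⁺ c∈X c⊆U = ∈face⁺ _ (proj₂ (restrict-inside w (max t∈X) (p⊆p∪q (β s))) (max c∈X , c⊆U))
    vertices : ∀ {u} → u ∈ X → u ≡ t ⊎ u ≡ s
    vertices {u} u∈X = between-adjacent x∈t t-x⊆s C⊆u u⊆U
      where
      C⊆u : C ⊆ β u
      C⊆u = proj₂ (X∩star (fills (face-isFace _) (X∩star⁺ t∈X (p-x⊆p (β t) x)) (X∩star⁺ s∈X t-x⊆s)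
                             (λ c∈ → ∈X (proj₁ (X∩star c∈))) u∈X))
      u⊆U : β u ⊆ U
      u⊆U = proj₂ (X∩inside (fills (face-isFace _) (X∩inside⁺ t∈X (p⊆p∪q (β s)))
                                 (X∩inside⁺ s∈X (q⊆p∪q (β t) (β s)))
                                 (λ c∈ → ∈X (proj₁ (X∩inside c∈))) u∈X))

  Spanning : Fin k → Fin k → Set
  Spanning a b = ∀ K → IsFace β K → a ∈ K → b ∈ K → ∀ c → c ∈ K

  Spanning-sym : ∀ {a b} → Spanning a b → Spanning b a
  Spanning-sym span K K-face b∈K a∈K = span K K-face a∈K b∈K

  PolygonDichotomy : Set
  PolygonDichotomy = ∀ a b → a ≢ b → Adj a b ⊎ Spanning a b

  -- The polygon is given by an edge {t, s} (β s = β t - x + y) whose only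
  -- cover is P_M itself: a face containing t, s and a third vertex is everything.
  module Polygon (t s : Fin k) (x : Fin n) (x∈t : x ∈ β t) (x∉s : x ∉ β s)
                 (t-x⊆s : (β t - x) ⊆ β s)
                 (top : ∀ Z → IsFace β Z → t ∈ Z → s ∈ Z →
                        (∃ λ v → v ∈ Z × v ≢ t × v ≢ s) → ∀ c → c ∈ Z) where

    C U : Subset n
    C = β t - x
    U = β t ∪ β s

    C⊆t : C ⊆ β t
    C⊆t = p-x⊆p (β t) x

    -- β s = β t - x + y
    y-data : Adj s t
    y-data = Adj-sym (x , x∈t , x∉s , t-x⊆s)

    y : Fin n
    y = proj₁ y-data

    y∈s : y ∈ β s
    y∈s = proj₁ (proj₂ y-data)

    y∉t : y ∉ β t
    y∉t = proj₁ (proj₂ (proj₂ y-data))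

    s-y⊆t : (β s - y) ⊆ β t
    s-y⊆t = proj₂ (proj₂ (proj₂ y-data))

    t⊆U : β t ⊆ U
    t⊆U = p⊆p∪q (β s)

    s⊆U : β s ⊆ U
    s⊆U = q⊆p∪q (β t) (β s)

    common-subset : ∀ {S v} → S ⊆ β t → S ⊆ β s → S ⊆ β v → v ≢ t → v ≢ s → ∀ c → S ⊆ β c
    common-subset S⊆t S⊆s S⊆v v≢t v≢s c = star⁻ S⊆t
      (top _ (face-isFace _) (star⁺ S⊆t S⊆t) (star⁺ S⊆t S⊆s) (_ , star⁺ S⊆t S⊆v , v≢t , v≢s) c)

    common-superset : ∀ {S v} → β t ⊆ S → β s ⊆ S → β v ⊆ S → v ≢ t → v ≢ s → ∀ c → β c ⊆ S
    common-superset t⊆S s⊆S v⊆S v≢t v≢s c = inside⁻ t⊆S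
      (top _ (face-isFace _) (inside⁺ t⊆S t⊆S) (inside⁺ t⊆S s⊆S) (_ , inside⁺ t⊆S v⊆S , v≢t , v≢s) c)

    -- The square case: when only t and s contain C = β t - x or lie inside
    -- U = β t ∪ β s, P_M is a square t, s, m₁, m₂ with diagonals t m₂ and
    -- s m₁; here m₁ = β t - q + z comes from exchanging some q ∈ C.
    module Square (only-star : ∀ c → C ⊆ β c → c ≡ t ⊎ c ≡ s)
                  (only-inside : ∀ c → β c ⊆ U → c ≡ t ⊎ c ≡ s)
                  (q : Fin n) (q∈C : q ∈ C) (z : Fin n) (z∉t : z ∉ β t)
                  (m₁ : Fin k) (βm₁ : β m₁ ≡ (β t - q) ∪ ⁅ z ⁆) where

      q∈t : q ∈ β t
      q∈t = C⊆t q∈C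

      q∈s : q ∈ β s
      q∈s = t-x⊆s q∈C

      q≢x : q ≢ x
      q≢x = proj₂ (x∈p-y⁻ q∈C)

      ∈m₁⁻ : ∀ {e} → e ∈ β m₁ → (e ∈ β t × e ≢ q) ⊎ e ≡ z
      ∈m₁⁻ e∈ with x∈p∪⁅y⁆⁻ (subst (_ ∈_) βm₁ e∈)
      ... | inj₁ e∈t-q = inj₁ (x∈p-y⁻ e∈t-q)
      ... | inj₂ e≡z   = inj₂ e≡z

      ∈m₁⁺ : ∀ {e} → e ∈ β t → e ≢ q → e ∈ β m₁
      ∈m₁⁺ e∈t e≢q = subst (_ ∈_) (sym βm₁) (x∈p∪q⁺ (inj₁ (x∈p∧x≢y⇒x∈p-y e∈t e≢q)))

      z∈m₁ : z ∈ β m₁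
      z∈m₁ = subst (z ∈_) (sym βm₁) (y∈p∪⁅y⁆ z)

      q∉m₁ : q ∉ β m₁
      q∉m₁ q∈ with ∈m₁⁻ q∈
      ... | inj₁ (_ , q≢q) = q≢q refl
      ... | inj₂ refl      = z∉t q∈t

      x∈m₁ : x ∈ β m₁
      x∈m₁ = ∈m₁⁺ x∈t (q≢x ∘ sym)

      m₁≢t : m₁ ≢ t
      m₁≢t refl = q∉m₁ q∈t

      m₁≢s : m₁ ≢ s
      m₁≢s refl = q∉m₁ q∈s

      D : Subset n
      D = C - q

      ∈D⁺ : ∀ {e} → e ∈ β t → e ≢ x → e ≢ q → e ∈ D
      ∈D⁺ e∈t e≢x e≢q = x∈p∧x≢y⇒x∈p-y (x∈p∧x≢y⇒x∈p-y e∈t e≢x) e≢q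

      D-everywhere : ∀ c → D ⊆ β c
      D-everywhere = common-subset (C⊆t ∘ p-x⊆p C q) (t-x⊆s ∘ p-x⊆p C q) D⊆m₁ m₁≢t m₁≢s
        where
        D⊆m₁ : D ⊆ β m₁
        D⊆m₁ e∈D with x∈p-y⁻ e∈D
        ... | e∈C , e≢q = ∈m₁⁺ (C⊆t e∈C) e≢q

      z∉s : z ∉ β s
      z∉s z∈s with only-inside m₁ m₁⊆U
        where
        m₁⊆U : β m₁ ⊆ U
        m₁⊆U e∈ with ∈m₁⁻ e∈
        ... | inj₁ (e∈t , _) = t⊆U e∈t
        ... | inj₂ refl      = s⊆U z∈s
      ... | inj₁ m₁≡t = m₁≢t m₁≡t
      ... | inj₂ m₁≡s = m₁≢s m₁≡s

      U' : Subset n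
      U' = U ∪ ⁅ z ⁆

      ∈U'⁻ : ∀ {e} → e ∈ U' → e ∈ β t ⊎ e ∈ β s ⊎ e ≡ z
      ∈U'⁻ e∈ with x∈p∪⁅y⁆⁻ e∈
      ... | inj₂ e≡z = inj₂ (inj₂ e≡z)
      ... | inj₁ e∈U with x∈p∪q⁻ (β t) (β s) e∈U
      ...   | inj₁ e∈t = inj₁ e∈t
      ...   | inj₂ e∈s = inj₂ (inj₁ e∈s)

      inside-U' : ∀ c → β c ⊆ U'
      inside-U' = common-superset (x∈p∪q⁺ ∘ inj₁ ∘ t⊆U) (x∈p∪q⁺ ∘ inj₁ ∘ s⊆U) m₁⊆U' m₁≢t m₁≢s
        where
        m₁⊆U' : β m₁ ⊆ U'
        m₁⊆U' e∈ with ∈m₁⁻ e∈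
        ... | inj₁ (e∈t , _) = x∈p∪q⁺ (inj₁ (t⊆U e∈t))
        ... | inj₂ refl      = y∈p∪⁅y⁆ z

      exchanged-is-z : ∀ {e m} → e ∈ β m₁ → e ∉ β s → β m ≡ (β s - q) ∪ ⁅ e ⁆ → e ≡ z
      exchanged-is-z {e} {m} e∈m₁ e∉s βm with ∈m₁⁻ e∈m₁
      ... | inj₂ e≡z = e≡z
      ... | inj₁ (e∈t , _) with e Fin.≟ x
      ...   | no  e≢x = ⊥-elim (e∉s (t-x⊆s (x∈p∧x≢y⇒x∈p-y e∈t e≢x)))
      ...   | yes refl with only-inside m m⊆U
        where
        m⊆U : β m ⊆ U
        m⊆U f∈ with x∈p∪⁅y⁆⁻ (subst (_ ∈_) βm f∈)
        ... | inj₁ f∈s-q = s⊆U (p-x⊆p (β s) q f∈s-q)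
        ... | inj₂ refl  = t⊆U x∈t
      ...     | inj₂ refl = ⊥-elim (e∉s (subst (x ∈_) (sym βm) (y∈p∪⁅y⁆ x)))
      ...     | inj₁ refl with x∈p∪⁅y⁆⁻ (subst (q ∈_) βm q∈t)
      ...       | inj₁ q∈s-q = ⊥-elim (x∉p-x q q∈s-q)
      ...       | inj₂ q≡x   = ⊥-elim (q≢x q≡x)

      C⊆ : ∀ {c} → q ∈ β c → C ⊆ β c
      C⊆ {c} q∈c {e} e∈C with e Fin.≟ q
      ... | yes refl = q∈c
      ... | no  e≢q  = D-everywhere c (x∈p∧x≢y⇒x∈p-y e∈C e≢q)

      ⊆m₁ : ∀ {c} → q ∉ β c → y ∉ β c → β c ⊆ β m₁
      ⊆m₁ {c} q∉c y∉c f∈c with ∈U'⁻ (inside-U' c f∈c)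
      ... | inj₂ (inj₂ refl) = z∈m₁
      ... | inj₂ (inj₁ f∈s)  = ∈m₁⁺ (s-y⊆t (x∈p∧x≢y⇒x∈p-y f∈s (∈∧∉⇒≢ f∈c y∉c))) (∈∧∉⇒≢ f∈c q∉c)
      ... | inj₁ f∈t         = ∈m₁⁺ f∈t (∈∧∉⇒≢ f∈c q∉c)

      ⊆U : ∀ {c} → z ∉ β c → β c ⊆ U
      ⊆U {c} z∉c f∈c with ∈U'⁻ (inside-U' c f∈c)
      ... | inj₂ (inj₂ refl) = ⊥-elim (z∉c f∈c)
      ... | inj₂ (inj₁ f∈s)  = s⊆U f∈s
      ... | inj₁ f∈t         = t⊆U f∈t

      m₁⊆ : ∀ {c} → x ∈ β c → z ∈ β c → β m₁ ⊆ β c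
      m₁⊆ {c} x∈c z∈c {f} f∈m₁ with ∈m₁⁻ f∈m₁
      ... | inj₂ refl = z∈c
      ... | inj₁ (f∈t , f≢q) with f Fin.≟ x
      ...   | yes refl = x∈c
      ...   | no  f≢x  = D-everywhere c (∈D⁺ f∈t f≢x f≢q)

      y∉m₁ : y ∉ β m₁
      y∉m₁ y∈ with ∈m₁⁻ y∈
      ... | inj₁ (y∈t , _) = y∉t y∈t
      ... | inj₂ refl      = z∉s y∈s

      module Corner (m₂ : Fin k) (βm₂ : β m₂ ≡ (β s - q) ∪ ⁅ z ⁆) where

        ∈m₂⁻ : ∀ {e} → e ∈ β m₂ → (e ∈ β s × e ≢ q) ⊎ e ≡ z
        ∈m₂⁻ e∈ with x∈p∪⁅y⁆⁻ (subst (_ ∈_) βm₂ e∈)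
        ... | inj₁ e∈s-q = inj₁ (x∈p-y⁻ e∈s-q)
        ... | inj₂ e≡z   = inj₂ e≡z

        ∈m₂⁺ : ∀ {e} → e ∈ β s → e ≢ q → e ∈ β m₂
        ∈m₂⁺ e∈s e≢q = subst (_ ∈_) (sym βm₂) (x∈p∪q⁺ (inj₁ (x∈p∧x≢y⇒x∈p-y e∈s e≢q)))

        z∈m₂ : z ∈ β m₂
        z∈m₂ = subst (z ∈_) (sym βm₂) (y∈p∪⁅y⁆ z)

        q∉m₂ : q ∉ β m₂
        q∉m₂ q∈ with ∈m₂⁻ q∈
        ... | inj₁ (_ , q≢q) = q≢q refl
        ... | inj₂ refl      = z∉t q∈t

        x∉m₂ : x ∉ β m₂
        x∉m₂ x∈ with ∈m₂⁻ x∈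
        ... | inj₁ (x∈s , _) = x∉s x∈s
        ... | inj₂ refl      = z∉t x∈t

        ⊆m₂ : ∀ {c} → q ∉ β c → x ∉ β c → β c ⊆ β m₂
        ⊆m₂ {c} q∉c x∉c f∈c with ∈U'⁻ (inside-U' c f∈c)
        ... | inj₂ (inj₂ refl) = z∈m₂
        ... | inj₂ (inj₁ f∈s)  = ∈m₂⁺ f∈s (∈∧∉⇒≢ f∈c q∉c)
        ... | inj₁ f∈t = ∈m₂⁺ (t-x⊆s (x∈p∧x≢y⇒x∈p-y f∈t (∈∧∉⇒≢ f∈c x∉c))) (∈∧∉⇒≢ f∈c q∉c)

        Corner : Fin k → Set
        Corner c = c ≡ t ⊎ c ≡ s ⊎ c ≡ m₁ ⊎ c ≡ m₂

        t-or-s : ∀ {c} → c ≡ t ⊎ c ≡ s → Corner c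
        t-or-s (inj₁ c≡t) = inj₁ c≡t
        t-or-s (inj₂ c≡s) = inj₂ (inj₁ c≡s)

        classify : ∀ c → Corner c
        classify c with q ∈? β c
        ... | yes q∈c = t-or-s (only-star c (C⊆ q∈c))
        ... | no  q∉c with x ∈? β c
        ...   | no  x∉c = inj₂ (inj₂ (inj₂ (β-⊆-injective (⊆m₂ q∉c x∉c))))
        ...   | yes x∈c with y ∈? β c
        ...     | no  y∉c = inj₂ (inj₂ (inj₁ (β-⊆-injective (⊆m₁ q∉c y∉c))))
        ...     | yes y∈c with z ∈? β c
        ...       | no  z∉c = t-or-s (only-inside c (⊆U z∉c))
        ...       | yes z∈c =
                    ⊥-elim (y∉m₁ (subst (λ d → y ∈ β d) (sym (β-⊆-injective (m₁⊆ x∈c z∈c))) y∈c))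

        -- the diagonals have the same midpoint: χ_t + χ_m₂ = χ_s + χ_m₁
        balanced : ∀ w → W w t + W w m₂ ≡ W w s + W w m₁
        balanced w = +-cancelʳ-≡ _ _ (w q) (begin
            (W w t + W w m₂) + w q  ≡⟨ ℤP.+-assoc (W w t) (W w m₂) (w q) ⟩
            W w t + (W w m₂ + w q)  ≡⟨ cong (λ a → W w t + a) (exchanged βm₂ q∈s z∉s) ⟩
            W w t + (W w s + w z)   ≡⟨ x∙yz≈y∙xz (W w t) (W w s) (w z) ⟩
            W w s + (W w t + w z)   ≡⟨ cong (λ a → W w s + a) (sym (exchanged βm₁ q∈t z∉t)) ⟩
            W w s + (W w m₁ + w q)  ≡⟨ sym (ℤP.+-assoc (W w s) (W w m₁) (w q)) ⟩
            (W w s + W w m₁) + w q  ∎)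
          where
          open ≡-Reasoning
          exchanged : ∀ {m a} → β m ≡ (β a - q) ∪ ⁅ z ⁆ → q ∈ β a → z ∉ β a → W w m + w q ≡ W w a + w z
          exchanged {a = a} βm q∈a z∉a =
            trans (cong (λ B → weight w B + w q) βm) (weight-exchange w (β a) q z q∈a z∉a)

        spanning-t-m₂ : Spanning t m₂
        spanning-t-m₂ K K-face t∈K m₂∈K with balanced-pair balanced K-face t∈K m₂∈K
        ... | s∈K , m₁∈K = top K K-face t∈K s∈K (m₁ , m₁∈K , m₁≢t , m₁≢s)

        spanning-s-m₁ : Spanning s m₁
        spanning-s-m₁ K K-face s∈K m₁∈K with balanced-pair (sym ∘ balanced) K-face s∈K m₁∈K
        ... | t∈K , _ = top K K-face t∈K s∈K (m₁ , m₁∈K , m₁≢t , m₁≢s)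

        adj-t-s : Adj t s
        adj-t-s = x , x∈t , x∉s , t-x⊆s

        adj-t-m₁ : Adj t m₁
        adj-t-m₁ = q , q∈t , q∉m₁ , λ e∈ → subst (_ ∈_) (sym βm₁) (x∈p∪q⁺ (inj₁ e∈))

        adj-s-m₂ : Adj s m₂
        adj-s-m₂ = q , q∈s , q∉m₂ , λ e∈ → subst (_ ∈_) (sym βm₂) (x∈p∪q⁺ (inj₁ e∈))

        adj-m₁-m₂ : Adj m₁ m₂
        adj-m₁-m₂ = x , x∈m₁ , x∉m₂ , m₁-x⊆m₂
          where
          m₁-x⊆m₂ : (β m₁ - x) ⊆ β m₂
          m₁-x⊆m₂ f∈ with x∈p-y⁻ f∈
          ... | f∈m₁ , f≢x with ∈m₁⁻ f∈m₁
          ...   | inj₂ refl        = z∈m₂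
          ...   | inj₁ (f∈t , f≢q) = ∈m₂⁺ (t-x⊆s (x∈p∧x≢y⇒x∈p-y f∈t f≢x)) f≢q

        dichotomy : PolygonDichotomy
        dichotomy a b a≢b with classify a | classify b
        ... | inj₁ refl                 | inj₁ refl                 = ⊥-elim (a≢b refl)
        ... | inj₁ refl                 | inj₂ (inj₁ refl)          = inj₁ adj-t-s
        ... | inj₁ refl                 | inj₂ (inj₂ (inj₁ refl))   = inj₁ adj-t-m₁
        ... | inj₁ refl                 | inj₂ (inj₂ (inj₂ refl))   = inj₂ spanning-t-m₂
        ... | inj₂ (inj₁ refl)          | inj₁ refl                 = inj₁ (Adj-sym adj-t-s)
        ... | inj₂ (inj₁ refl)          | inj₂ (inj₁ refl)          = ⊥-elim (a≢b refl)
        ... | inj₂ (inj₁ refl)          | inj₂ (inj₂ (inj₁ refl))   = inj₂ spanning-s-m₁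
        ... | inj₂ (inj₁ refl)          | inj₂ (inj₂ (inj₂ refl))   = inj₁ adj-s-m₂
        ... | inj₂ (inj₂ (inj₁ refl))   | inj₁ refl                 = inj₁ (Adj-sym adj-t-m₁)
        ... | inj₂ (inj₂ (inj₁ refl))   | inj₂ (inj₁ refl)          = inj₂ (Spanning-sym spanning-s-m₁)
        ... | inj₂ (inj₂ (inj₁ refl))   | inj₂ (inj₂ (inj₁ refl))   = ⊥-elim (a≢b refl)
        ... | inj₂ (inj₂ (inj₁ refl))   | inj₂ (inj₂ (inj₂ refl))   = inj₁ adj-m₁-m₂
        ... | inj₂ (inj₂ (inj₂ refl))   | inj₁ refl                 = inj₂ (Spanning-sym spanning-t-m₂)
        ... | inj₂ (inj₂ (inj₂ refl))   | inj₂ (inj₁ refl)          = inj₁ (Adj-sym adj-s-m₂)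
        ... | inj₂ (inj₂ (inj₂ refl))   | inj₂ (inj₂ (inj₁ refl))   = inj₁ (Adj-sym adj-m₁-m₂)
        ... | inj₂ (inj₂ (inj₂ refl))   | inj₂ (inj₂ (inj₂ refl))   = ⊥-elim (a≢b refl)

      -- m₂ arises by exchanging q out of β s against m₁
      square-dichotomy : PolygonDichotomy
      square-dichotomy with exchange q∈s q∉m₁
      ... | e , e∈m₁ , e∉s , m₂ , βm₂ with exchanged-is-z e∈m₁ e∉s βm₂
      ...   | refl = Corner.dichotomy m₂ βm₂

    AllAdj⇒dichotomy : AllAdj → PolygonDichotomy
    AllAdj⇒dichotomy all-adj a b a≢b = inj₁ (all-adj a b a≢b)

    Other : (Fin k → Set) → Set
    Other P = ∃ λ v → P v × v ≢ t × v ≢ s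

    other? : ∀ {P : Fin k → Set} → (∀ v → Dec (P v)) → Dec (Other P)
    other? P? = any? (λ v → P? v ×-dec (¬? (v Fin.≟ t) ×-dec ¬? (v Fin.≟ s)))

    no-other : ∀ {P : Fin k → Set} → ¬ Other P → ∀ c → P c → c ≡ t ⊎ c ≡ s
    no-other none c Pc with c Fin.≟ t | c Fin.≟ s
    ... | yes c≡t | _       = inj₁ c≡t
    ... | no  _   | yes c≡s = inj₂ c≡s
    ... | no  c≢t | no  c≢s = ⊥-elim (none (c , Pc , c≢t , c≢s))

    ∣U∣≤r+1 : ∣ U ∣ ℕ.≤ suc ∣ β t ∣
    ∣U∣≤r+1 = ℕP.≤-trans (p⊆q⇒∣p∣≤∣q∣ U⊆s+x)
                (ℕP.≤-reflexive (trans (∣p∪⁅y⁆∣≡1+∣p∣ (β s) x x∉s) (cong suc (rank-β s t))))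
      where
      U⊆s+x : U ⊆ β s ∪ ⁅ x ⁆
      U⊆s+x {e} e∈U with x∈p∪q⁻ (β t) (β s) e∈U
      ... | inj₂ e∈s = x∈p∪q⁺ (inj₁ e∈s)
      ... | inj₁ e∈t with e Fin.≟ x
      ...   | yes refl = y∈p∪⁅y⁆ x
      ...   | no  e≢x  = x∈p∪q⁺ (inj₁ (t-x⊆s (x∈p∧x≢y⇒x∈p-y e∈t e≢x)))

    -- A third basis containing C, or inside U, forces all bases to be pairwise
    -- adjacent (a triangle); two vertices form a segment; otherwise a square.
    dichotomy : PolygonDichotomy
    dichotomy with other? (λ v → C ⊆? β v)
    ... | yes (v , C⊆v , v≢t , v≢s) = AllAdj⇒dichotomy (common-corank-one⇒AllAdj
            (common-subset C⊆t t-x⊆s C⊆v v≢t v≢s) (1+∣p-x∣≡∣p∣ (β t) x x∈t))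
    ... | no no-C with other? (λ v → β v ⊆? U)
    ...   | yes (v , v⊆U , v≢t , v≢s) = AllAdj⇒dichotomy (common-small-superset⇒AllAdj
              (common-superset t⊆U s⊆U v⊆U v≢t v≢s) ∣U∣≤r+1)
    ...   | no no-U with other? {P = λ _ → Unit} (λ _ → yes tt)
    ...     | no only-two = AllAdj⇒dichotomy (two-vertices⇒AllAdj (x , x∈t , x∉s , t-x⊆s) (λ c → no-other only-two c tt))
    ...     | yes (u , _ , u≢t , u≢s) with ⊈-witness (λ C⊆u → no-C (u , C⊆u , u≢t , u≢s))
    ...       | q , q∈C , q∉u with exchange (C⊆t q∈C) q∉u
    ...         | z , _ , z∉t , m₁ , βm₁ =
                  Square.square-dichotomy (no-other no-C) (no-other no-U) q q∈C z z∉t m₁ βm₁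

  -- The polygon case: a chain ⊥ ⋖ {t} ⋖ {t, s} ⋖ P_M.
  polygon-dichotomy : Chain β ⊥ 3 → PolygonDichotomy
  polygon-dichotomy (G₁ , ⊥⋖G₁ , G₂ , G₁⋖G₂ , G₃ , G₂⋖G₃ , G₃≡⊤) with vertex ⊥⋖G₁
  ... | t , refl = Polygon.dichotomy t s x x∈t x∉s t-x⊆s top
    where
    open Edge (edge G₁⋖G₂)
    top : ∀ Z → IsFace β Z → t ∈ Z → s ∈ Z → (∃ λ v → v ∈ Z × v ≢ t × v ≢ s) → ∀ c → c ∈ Z
    top Z Z-face t∈Z s∈Z (v , v∈Z , v≢t , v≢s) c =
      fills-cover G₂⋖G₃ Z-face G₂⊆Z (v , v∈Z , v∉G₂) (λ _ → G₃-all) G₃-all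
      where
      G₃-all : ∀ {e} → e ∈ G₃
      G₃-all = subst (_ ∈_) (sym G₃≡⊤) ∈⊤
      G₂⊆Z : G₂ ⊆ Z
      G₂⊆Z u∈G₂ with vertices u∈G₂
      ... | inj₁ refl = t∈Z
      ... | inj₂ refl = s∈Z
      v∉G₂ : v ∉ G₂
      v∉G₂ v∈G₂ with vertices v∈G₂
      ... | inj₁ v≡t = v≢t v≡t
      ... | inj₂ v≡s = v≢s v≡s

  Attached : Fin k → Set
  Attached j = ∀ σ → σ ⊆ β j → ∀ i → i Fin.< j → σ ⊆ β i →
               ∃ λ i' → i' Fin.< j × Adj j i' × σ ⊆ β i'

  -- If every β j with j ≥ 1 is attached, ⟨β 0, …, β (j-1)⟩ ∩ ⟨β j⟩ is
  -- generated by the sets β j - x (x ∈ β j ∖ β i', i' < j adjacent), so it is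
  -- pure of dimension r - 2.
  shelling-criterion : (∀ j → 1 ℕ.≤ toℕ j → Attached j) → IsComplexShelling β
  shelling-criterion attached j 1≤j = in-a-facet , small
    where
    in-a-facet : ∀ σ → (σ ⊆ β j × ∃ λ i → i Fin.< j × σ ⊆ β i) →
                 ∃ λ τ → (τ ⊆ β j × ∃ λ i → i Fin.< j × τ ⊆ β i) × σ ⊆ τ × ∣ τ ∣ ≡ ∣ β j ∣ ∸ 1
    in-a-facet σ (σ⊆j , i , i<j , σ⊆i) with attached j 1≤j σ σ⊆j i i<j σ⊆i
    ... | i' , i'<j , (x , x∈j , x∉i' , j-x⊆i') , σ⊆i' =
          β j - x , (p-x⊆p (β j) x , i' , i'<j , j-x⊆i') ,
          (λ e∈σ → x∈p∧x≢y⇒x∈p-y (σ⊆j e∈σ) (∈∧∉⇒≢ (σ⊆i' e∈σ) x∉i')) ,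
          cong (_∸ 1) (1+∣p-x∣≡∣p∣ (β j) x x∈j)
    -- σ ⊆ β j ∩ β i with i ≠ j is a proper subset of β j
    small : ∀ σ → (σ ⊆ β j × ∃ λ i → i Fin.< j × σ ⊆ β i) → ∣ σ ∣ ℕ.≤ ∣ β j ∣ ∸ 1
    small σ (σ⊆j , i , i<j , σ⊆i) with ∣ β j ∣ ℕ.≤? ∣ σ ∣
    ... | no  ≰ = <⇒≤∸1 (ℕP.≰⇒> ≰)
    ... | yes ≤ = ⊥-elim (FP.<⇒≢ i<j (sym (β-⊆-injective j⊆i)))
      where
      j⊆i : β j ⊆ β i
      j⊆i e∈j = σ⊆i (subst (_ ∈_) (sym (⊆∧∣≥∣⇒≡ σ⊆j ≤)) e∈j)

  L : List (Subset k)
  L = dualFacetOrder k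

  facet-at : (i : Fin (length L)) → ∃ λ a → List.lookup L i ≡ ⁅ a ⁆ × toℕ a ≡ toℕ i
  facet-at = entry-at ⁅_⁆ (λ a → a)

  index-of : (a : Fin k) → ∃ λ (i : Fin (length L)) → List.lookup L i ≡ ⁅ a ⁆ × toℕ i ≡ toℕ a
  index-of = position-of ⁅_⁆ (λ a → a)

  -- A point: only one basis, so nothing to check.
  attached-dim0 : Chain β ⊥ 1 → ∀ j → 1 ℕ.≤ toℕ j → Attached j
  attached-dim0 (G₁ , ⊥⋖G₁ , G₁≡⊤) Fin.zero ()
  attached-dim0 (G₁ , ⊥⋖G₁ , G₁≡⊤) (Fin.suc j) _ with vertex ⊥⋖G₁
  ... | t , refl = ⊥-elim (FP.0≢1+n (trans (is-t Fin.zero) (sym (is-t (Fin.suc j)))))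
    where
    is-t : ∀ c → c ≡ t
    is-t c = x∈⁅y⁆⇒x≡y t (subst (c ∈_) (sym G₁≡⊤) ∈⊤)

  -- A segment: the two bases are adjacent.
  attached-dim1 : Chain β ⊥ 2 → ∀ j → 1 ℕ.≤ toℕ j → Attached j
  attached-dim1 (G₁ , ⊥⋖G₁ , G₂ , G₁⋖G₂ , G₂≡⊤) j _ σ _ i i<j σ⊆i with vertex ⊥⋖G₁
  ... | t , refl =
        i , i<j , two-vertices⇒AllAdj (x , x∈t , x∉s , t-x⊆s) t-or-s j i (FP.<⇒≢ i<j ∘ sym) , σ⊆i
    where
    open Edge (edge G₁⋖G₂)
    t-or-s : ∀ c → c ≡ t ⊎ c ≡ s
    t-or-s c = vertices (subst (c ∈_) (sym G₂≡⊤) ∈⊤)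

  -- A polygon: if β i (i < j) is not adjacent to β j, the two span P_M, so σ
  -- lies in every basis; the polygon shelling provides an earlier a whose
  -- edge-sharing vertex of P_M^* is a proper face of P_M containing j and a,
  -- so a and j do not span and are adjacent.
  attached-dim2 : Chain β ⊥ 3 → Shelling 2 β ⊥ L → ∀ j → 1 ℕ.≤ toℕ j → Attached j
  attached-dim2 chain (_ , step) j 1≤j σ σ⊆j i i<j σ⊆i
    with polygon-dichotomy chain j i (FP.<⇒≢ i<j ∘ sym)
  ... | inj₁ adj = i , i<j , adj , σ⊆i
  ... | inj₂ j-i-span with index-of j
  ...   | jL , Lj≡ , jL≡j with step jL (subst (1 ℕ.≤_) (sym jL≡j) 1≤j)
  ...     | aL , aL<jL , K , (_ , (K-face , _ , (_ , w , _ , w∉K) , _) , _) , Lj⊆K , La⊆K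
    with facet-at aL
  ...       | a , La≡ , a≡aL with polygon-dichotomy chain j a (FP.<⇒≢ (reindex-< a≡aL jL≡j aL<jL) ∘ sym)
  ...         | inj₁ adj = a , reindex-< a≡aL jL≡j aL<jL , adj , σ⊆a
    where
    σ⊆a : σ ⊆ β a
    σ⊆a = star⁻ σ⊆j (j-i-span _ (face-isFace _) (star⁺ σ⊆j σ⊆j) (star⁺ σ⊆j σ⊆i) a)
  ...         | inj₂ j-a-span = ⊥-elim (w∉K (j-a-span K K-face j∈K a∈K w))
    where
    j∈K : j ∈ K
    j∈K = Lj⊆K (subst (j ∈_) (sym Lj≡) (x∈⁅x⁆ j))
    a∈K : a ∈ K
    a∈K = La⊆K (subst (a ∈_) (sym La≡) (x∈⁅x⁆ a))

  shelling-facets : ∀ d {G L'} → Shelling (suc (suc d)) β G L' → FacetOrder β G L'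
  shelling-facets zero    (facets , _) = facets
  shelling-facets (suc d) (facets , _) = facets

  -- Dimension ≥ 3: the star face F of σ contains i and j, so the face of
  -- P_M^* dual to F lies in F_{β j} and in the earlier F_{β i}; the shelling
  -- puts it inside an earlier-attached facet of F_{β j}, i.e. an edge {j, a}
  -- of P_M inside F with a < j.
  attached-dim≥3 : ∀ d → Shelling (suc (suc (suc d))) β ⊥ L → ∀ j → 1 ℕ.≤ toℕ j → Attached j
  attached-dim≥3 d (_ , step) j 1≤j σ σ⊆j i i<j σ⊆i with index-of j | index-of i
  ... | jL , Lj≡ , jL≡j | iL , Li≡ , iL≡i
    with step jL (subst (1 ℕ.≤_) (sym jL≡j) 1≤j)
  ... | L' , facets-of-j , r , _ , _ , earlier , covered
    with covered (face (ind σ)) (face-isFace _)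
                 (subst (_⊆ face (ind σ)) (sym Lj≡) (⁅x⁆⊆p (star⁺ σ⊆j σ⊆j)))
                 (iL , reindex-< iL≡i (sym jL≡j) i<j ,
                  subst (_⊆ face (ind σ)) (sym Li≡) (⁅x⁆⊆p (star⁺ σ⊆j σ⊆i)))
  ... | X , X∈segment , X⊆F with earlier X X∈segment
  ... | aL , aL<jL , La⊆X with facet-at aL
  ... | a , La≡ , a≡aL =
        a , a<j , edge-adjacent j⋖X a∈X (FP.<⇒≢ a<j) , star⁻ σ⊆j (X⊆F a∈X)
    where
    a<j : a Fin.< j
    a<j = reindex-< a≡aL jL≡j aL<jL
    a∈X : a ∈ X
    a∈X = La⊆X (subst (a ∈_) (sym La≡) (x∈⁅x⁆ a))
    j⋖X : Covers β ⁅ j ⁆ X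
    j⋖X = subst (λ G → Covers β G X) Lj≡
            (proj₁ (proj₁ (shelling-facets d facets-of-j) X) (∈-take r L' X∈segment))

  attached : ∀ d → Chain β ⊥ (suc d) → Shelling d β ⊥ L → ∀ j → 1 ℕ.≤ toℕ j → Attached j
  attached 0                      chain _        = attached-dim0 chain
  attached 1                      chain _        = attached-dim1 chain
  attached 2                      chain shelling = attached-dim2 chain shelling
  attached (suc (suc (suc d)))    _     shelling = attached-dim≥3 d shelling

theorem1p1 : (n : ℕ) (M : Matroid n) (k : ℕ) (β : Fin k → Subset n) →
    BasisOrder M k β →
    (d : ℕ) → Chain β ⊥ (suc d) →
    Shelling d β ⊥ (dualFacetOrder k) →
    IsComplexShelling β
theorem1p1 n M k β order d chain shelling =
  shelling-criterion (attached d chain shelling)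
  where open MatroidPolytope M β order
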